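{- Let $\Pi_q$ be a projective plane (not necessarily Desarguesian) of order $q$, and let $s(2,q)$ denote the smallest size of a saturating set in $\Pi_q$. Then \[ s(2,q)\leq 2\sqrt{(q+1)\ln (q+1)}+2 . \]
   Context: A point set $S$ of a projective plane $\Pi_q$ is called saturating if every point of $\Pi_q\setminus S$ is collinear with two points of $S$ (i.e. lies on a line meeting $S$ in at least two points). -}

module Defs where

open import Data.Nat using (ℕ; zero; suc; _+_; _*_; _∸_; _^_; _≤_)
open import Data.Nat.Properties using (_!≢0)
open import Data.Nat using (_!)
open import Data.Integer using (+_)
open import Data.Rational as ℚ using (ℚ; _/_)
open import Data.Fin using (Fin)
open import Data.Fin.Subset using (Subset; _∈_; _∉_; ∣_∣)
open import Data.Bool using (Bool; true)
open import Data.List using (filter; length)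
open import Data.List using () renaming (allFin to allFinL)
open import Data.Sum using (_⊎_)
open import Data.Product using (Σ; ∃; ∃-syntax; _×_; _,_)
open import Relation.Binary.PropositionalEquality using (_≡_; _≢_)
open import Relation.Nullary using (¬_)
open import Data.Bool using (T)
open import Relation.Nullary.Decidable using (Dec)
open import Data.Bool.Properties using (T?)

record IncidenceStructure : Set where
  field
    v b : ℕ
    _I_ : Fin v → Fin b → Bool

  _on_ : Fin v → Fin b → Set
  p on ℓ = T (p I ℓ)

  lineSize : Fin b → ℕ
  lineSize ℓ = length (filter (λ p → T? (p I ℓ)) (allFinL v))

  Collinear : Fin v → Fin v → Fin v → Set
  Collinear x y z = ∃[ ℓ ] (x on ℓ × y on ℓ × z on ℓ)

open IncidenceStructure public

record IsProjectivePlaneOfOrder (q : ℕ) (Π : IncidenceStructure) : Set where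
  field
    joinLine : ∀ (p r : Fin (v Π)) → p ≢ r →
               ∃[ ℓ ] (_on_ Π p ℓ × _on_ Π r ℓ)
    joinUnique : ∀ (p r : Fin (v Π)) (ℓ m : Fin (b Π)) → p ≢ r →
                 _on_ Π p ℓ → _on_ Π r ℓ → _on_ Π p m → _on_ Π r m → ℓ ≡ m
    meetPoint : ∀ (ℓ m : Fin (b Π)) → ℓ ≢ m →
                ∃[ p ] (_on_ Π p ℓ × _on_ Π p m)
    meetUnique : ∀ (ℓ m : Fin (b Π)) (p r : Fin (v Π)) → ℓ ≢ m →
                 _on_ Π p ℓ → _on_ Π p m → _on_ Π r ℓ → _on_ Π r m → p ≡ r
    quadrangle : Σ (Fin (v Π)) λ p₁ → Σ (Fin (v Π)) λ p₂ →
                 Σ (Fin (v Π)) λ p₃ → Σ (Fin (v Π)) λ p₄ →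
                 ¬ Collinear Π p₁ p₂ p₃ × ¬ Collinear Π p₁ p₂ p₄ ×
                 ¬ Collinear Π p₁ p₃ p₄ × ¬ Collinear Π p₂ p₃ p₄
    order : ∀ (ℓ : Fin (b Π)) → lineSize Π ℓ ≡ suc q

Saturating : (Π : IncidenceStructure) → Subset (v Π) → Set
Saturating Π S = ∀ p → p ∉ S →
  Σ (Fin (v Π)) λ x → Σ (Fin (v Π)) λ y →
    x ≢ y × x ∈ S × y ∈ S × Collinear Π p x y

-- Exponential without reals.
-- expPartial m n = Σ_{j=0}^{n} m^j / j!  (a rational number)
expPartial : ℕ → ℕ → ℚ
expPartial m zero = ℚ.1ℚ
expPartial m (suc n) = expPartial m n ℚ.+ ((+ (m ^ suc n)) / (suc n !))
  where instance _ = suc n !≢0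

-- e^m ≤ N  (e^m is the supremum of its partial sums)
ExpLe : ℕ → ℕ → Set
ExpLe m N = ∀ n → expPartial m n ℚ.≤ (+ N / 1)

-- k ≤ 2 √(X ln X) + 2, for naturals k and X ≥ 1, equivalently:
-- k ≤ 2, or (k-2)² ≤ 4 X ln X, i.e. e^((k-2)²) ≤ X^(4X).
BoundHolds : ℕ → ℕ → Set
BoundHolds k X = k ≤ 2 ⊎ ExpLe ((k ∸ 2) ^ 2) (X ^ (4 * X))

{-# OPTIONS --safe #-}
module Submission where

-- Greedy construction. Put N = q² + q + 1, an upper bound for the number of points, and call P
-- uncovered by S if P ∉ S and no line through P meets S twice. Such a P becomes covered when one
-- adds P itself or one of the q - 1 points other than P and s on the line Ps, s ∈ S; these
-- 1 + (q - 1)|S| points are distinct because P is uncovered. Averaging over the added point, a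
-- greedy step multiplies the number of uncovered points by at most 1 - (1 + (q - 1)|S|)/N, so
-- after k steps at most N (1 - 1/N)^G(k) remain, G(k) = Σ_{j<k} (1 + (q - 1) j). Let k be a step
-- at which this bound drops below 1 while it was still ≥ 1 at k - 1. With B = N - 1 and
-- e ≤ (1 + 1/B)^(B+1), the bound at k - 1 gives G(k - 1) ≤ N ln N, and N (k - 2)² ≤ 2 (q + 1) G(k - 1)
-- as long as k ≤ q + 2; hence (k - 2)² ≤ 4 (q + 1) ln (q + 1). For q ≥ 8 the bound is below 1 at
-- k = q + 2 (for large q because (1 + 1/B)^B ≥ 2), and for q ≤ 7 suitable k are checked by evaluation.

open import Defs hiding (_on_; Collinear)
open import Data.Bool using (if_then_else_)
open import Data.Bool.Properties using (T?; ∨-identityʳ)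
open import Data.Empty using (⊥-elim)
open import Data.Fin using (Fin; zero; suc)
open import Data.Fin.Properties using (_≟_; any?)
import Data.Fin.Properties as Fin
open import Data.Fin.Subset using (Subset; inside; outside; _∈_; _∉_; ∣_∣; _∪_; ⁅_⁆) renaming (⊥ to ∅)
open import Data.Fin.Subset.Properties using (_∈?_; ∪-identityʳ; ∣⊥∣≡0; p⊆p∪q; q⊆p∪q; x∈⁅x⁆)
import Data.Integer as ℤ
open import Data.Integer.Properties using (pos-+; pos-*)
open import Data.List using (length; filter; tabulate)
open import Data.Nat hiding (_≟_)
open import Data.Nat.Properties hiding (_≟_)
open import Data.Nat.Tactic.RingSolver using (solve-∀)
open import Data.Product using (Σ; ∃; ∃-syntax; _×_; _,_; proj₁; proj₂)
import Data.Rational as ℚ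
open import Data.Rational using (toℚᵘ)
open import Data.Rational.Properties using (toℚᵘ-fromℚᵘ; toℚᵘ-homo-+; toℚᵘ-cancel-≤) renaming (≤-trans to ℚ-≤-trans)
open import Data.Rational.Unnormalised as ℚᵘ using (ℚᵘ; mkℚᵘ; *≡*; *≤*)
import Data.Rational.Unnormalised.Properties as ℚᵘ
open import Data.Sum using (inj₁; inj₂)
open import Data.Unit using (tt)
open import Data.Vec using (_∷_; []; here; there)
open import Function using (_∘_; id)
open import Relation.Binary.PropositionalEquality
open import Relation.Nullary using (Dec; yes; no; does; ¬_; _×-dec_; ¬?)
open import Relation.Nullary.Decidable using (decidable-stable)
open import Relation.Unary using (Decidable)

open import Algebra.Properties.CommutativeSemigroup *-commutativeSemigroup
  using (interchange; x∙yz≈y∙xz; x∙yz≈xz∙y; xy∙z≈y∙xz; xy∙z≈xz∙y)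
open import Algebra.Properties.Semiring.Sum +-*-semiring
  using (sum; sum-syntax; ∑-comm; ∑-distrib-+; sum-cong-≗; sum-replicate-zero; *-distribʳ-sum)

-- Sums and counting over Fin n

∑-mono-≤ : ∀ {n} {f g : Fin n → ℕ} → (∀ i → f i ≤ g i) → sum f ≤ sum g
∑-mono-≤ {zero}  f≤g = z≤n
∑-mono-≤ {suc n} f≤g = +-mono-≤ (f≤g zero) (∑-mono-≤ (f≤g ∘ suc))

∑-const : ∀ n c → ∑[ i < n ] c ≡ n * c
∑-const zero    c = refl
∑-const (suc n) c = cong (c +_) (∑-const n c)

∃-≥-average : ∀ {n} (f : Fin n → ℕ) → Fin n → ∃[ i ] sum f ≤ n * f i
∃-≥-average {suc zero}    f _ = zero , ≤-refl
∃-≥-average {suc (suc n)} f _ with ∃-≥-average (f ∘ suc) zero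
... | i , tail≤ with f zero ≤? f (suc i)
...   | yes f₀≤ = suc i , +-mono-≤ f₀≤ tail≤
...   | no  f₀≰ = zero , +-monoʳ-≤ (f zero) (≤-trans tail≤ (*-monoʳ-≤ (suc n) (<⇒≤ (≰⇒> f₀≰))))

𝟙 : ∀ {a} {A : Set a} → Dec A → ℕ
𝟙 a? = if does a? then 1 else 0

count : ∀ {n} {P : Fin n → Set} → Decidable P → ℕ
count {n} P? = ∑[ i < n ] 𝟙 (P? i)

𝟙-mono : ∀ {a b} {A : Set a} {B : Set b} (a? : Dec A) (b? : Dec B) → (A → B) → 𝟙 a? ≤ 𝟙 b?
𝟙-mono (yes _) (yes _) _   = ≤-refl
𝟙-mono (yes a) (no ¬b) A⇒B = ⊥-elim (¬b (A⇒B a))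
𝟙-mono (no _)  _       _   = z≤n

𝟙≤1 : ∀ {a} {A : Set a} (a? : Dec A) → 𝟙 a? ≤ 1
𝟙≤1 (yes _) = ≤-refl
𝟙≤1 (no _)  = z≤n

𝟙-yes : ∀ {a} {A : Set a} (a? : Dec A) → A → 𝟙 a? ≡ 1
𝟙-yes (yes _) _ = refl
𝟙-yes (no ¬a) a = ⊥-elim (¬a a)

module _ {n : ℕ} {P : Fin n → Set} (P? : Decidable P) where

  count-none : (∀ i → ¬ P i) → count P? ≡ 0
  count-none none = trans (sum-cong-≗ 𝟙≡0) (sum-replicate-zero n)
    where
    𝟙≡0 : ∀ i → 𝟙 (P? i) ≡ 0
    𝟙≡0 i with P? i
    ... | yes p = ⊥-elim (none i p)
    ... | no _  = refl

  count-mono : ∀ {Q} (Q? : Decidable Q) → (∀ {i} → P i → Q i) → count P? ≤ count Q?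
  count-mono Q? P⇒Q = ∑-mono-≤ λ i → 𝟙-mono (P? i) (Q? i) P⇒Q

  count≤n : count P? ≤ n
  count≤n = ≤-trans (∑-mono-≤ (𝟙≤1 ∘ P?)) (≤-reflexive (trans (∑-const n 1) (*-identityʳ n)))

count-cong : ∀ {n} {P Q : Fin n → Set} (P? : Decidable P) (Q? : Decidable Q) →
             (∀ {i} → P i → Q i) → (∀ {i} → Q i → P i) → count P? ≡ count Q?
count-cong P? Q? P⇒Q Q⇒P = ≤-antisym (count-mono P? Q? P⇒Q) (count-mono Q? P? Q⇒P)

count-≟ : ∀ {n} (a : Fin n) → count (_≟ a) ≡ 1
count-≟ {suc n} zero    = cong suc (count-none {n} (λ i → suc i ≟ zero) (λ _ ()))
count-≟ {suc n} (suc a) = count-≟ a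

1≤count : ∀ {n} {P : Fin n → Set} (P? : Decidable P) {i} → P i → 1 ≤ count P?
1≤count P? {i} p = subst (_≤ count P?) (count-≟ i) (count-mono (_≟ i) P? λ { refl → p })

count-pos⇒∃ : ∀ {n} {P : Fin n → Set} (P? : Decidable P) → 0 < count P? → ∃ P
count-pos⇒∃ P? 0<count with any? P?
... | yes witness = witness
... | no  none    = ⊥-elim (<⇒≢ 0<count (sym (count-none P? λ i p → none (i , p))))

count-≤1 : ∀ {n} {P : Fin n → Set} (P? : Decidable P) →
           (∀ {i j} → P i → P j → i ≡ j) → count P? ≤ 1
count-≤1 {zero}  P? unique = z≤n
count-≤1 {suc n} P? unique with P? zero
... | yes p₀ = ≤-reflexive (cong suc (count-none (P? ∘ suc) λ _ p → Fin.0≢1+n (unique p₀ p)))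
... | no _   = count-≤1 (P? ∘ suc) λ p q → Fin.suc-injective (unique p q)

count≤𝟙 : ∀ {n a} {P : Fin n → Set} {A : Set a} (P? : Decidable P) (A? : Dec A) →
          (∀ {i j} → P i → P j → i ≡ j) → (∀ {i} → P i → A) → count P? ≤ 𝟙 A?
count≤𝟙 P? (yes _) unique _   = count-≤1 P? unique
count≤𝟙 P? (no ¬a) _      P⇒A = ≤-reflexive (count-none P? λ _ → ¬a ∘ P⇒A)

count-remove : ∀ {n} {P : Fin n → Set} (P? : Decidable P) {a} → P a →
               count P? ≡ suc (count (λ i → P? i ×-dec ¬? (i ≟ a)))
count-remove {n} P? {a} pa = begin
  count P?                                 ≡⟨ sum-cong-≗ split ⟩
  ∑[ i < n ] (𝟙 (P∖a? i) + 𝟙 (i ≟ a))      ≡⟨ ∑-distrib-+ (𝟙 ∘ P∖a?) (𝟙 ∘ (_≟ a)) ⟩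
  count P∖a? + count (_≟ a)                ≡⟨ cong (count P∖a? +_) (count-≟ a) ⟩
  count P∖a? + 1                           ≡⟨ +-comm (count P∖a?) 1 ⟩
  suc (count P∖a?)                         ∎
  where
  open ≡-Reasoning
  P∖a? = λ i → P? i ×-dec ¬? (i ≟ a)
  split : ∀ i → 𝟙 (P? i) ≡ 𝟙 (P∖a? i) + 𝟙 (i ≟ a)
  split i with P? i | i ≟ a
  ... | yes _  | yes _    = refl
  ... | yes _  | no _     = refl
  ... | no ¬pi | yes refl = ⊥-elim (¬pi pa)
  ... | no _   | no _     = refl

count-×ˡ : ∀ {n} {A : Set} {Q : Fin n → Set} (A? : Dec A) (Q? : Decidable Q) →
           count (λ i → A? ×-dec Q? i) ≡ 𝟙 A? * count Q?
count-×ˡ     (yes _) Q? = sym (+-identityʳ _)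
count-×ˡ {n} (no _)  Q? = sum-replicate-zero n

∑-𝟙*-const : ∀ {n} {P : Fin n → Set} (P? : Decidable P) (f : Fin n → ℕ) {c} →
             (∀ {i} → P i → f i ≡ c) → ∑[ i < n ] (𝟙 (P? i) * f i) ≡ count P? * c
∑-𝟙*-const {n} P? f {c} f≡c = trans (sum-cong-≗ termwise) (sym (*-distribʳ-sum c (𝟙 ∘ P?)))
  where
  termwise : ∀ i → 𝟙 (P? i) * f i ≡ 𝟙 (P? i) * c
  termwise i with P? i
  ... | yes p = cong (_+ 0) (f≡c p)
  ... | no _  = refl

length-filter-tabulate : ∀ {n} {A : Set} {P : A → Set} (P? : Decidable P) (f : Fin n → A) →
                         length (filter P? (tabulate f)) ≡ ∑[ i < n ] 𝟙 (P? (f i))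
length-filter-tabulate {zero}  P? f = refl
length-filter-tabulate {suc n} P? f with P? (f zero)
... | yes _ = cong suc (length-filter-tabulate P? (f ∘ suc))
... | no _  = length-filter-tabulate P? (f ∘ suc)

∣p∣≡count∈ : ∀ {n} (p : Subset n) → ∣ p ∣ ≡ count (_∈? p)
∣p∣≡count∈ []            = refl
∣p∣≡count∈ (inside  ∷ p) = cong suc (∣p∣≡count∈ p)
∣p∣≡count∈ (outside ∷ p) = ∣p∣≡count∈ p

∣p∪⁅x⁆∣≡1+∣p∣ : ∀ {n} (p : Subset n) {x} → x ∉ p → ∣ p ∪ ⁅ x ⁆ ∣ ≡ suc ∣ p ∣
∣p∪⁅x⁆∣≡1+∣p∣ (inside  ∷ p) {zero}  x∉p = ⊥-elim (x∉p here)
∣p∪⁅x⁆∣≡1+∣p∣ (outside ∷ p) {zero}  _   = cong (suc ∘ ∣_∣) (∪-identityʳ p)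
∣p∪⁅x⁆∣≡1+∣p∣ (inside  ∷ p) {suc x} x∉p = cong suc (∣p∪⁅x⁆∣≡1+∣p∣ p (x∉p ∘ there))
∣p∪⁅x⁆∣≡1+∣p∣ (outside ∷ p) {suc x} x∉p = ∣p∪⁅x⁆∣≡1+∣p∣ p (x∉p ∘ there)

x∈p⇒p∪⁅x⁆≡p : ∀ {n} {p : Subset n} {x} → x ∈ p → p ∪ ⁅ x ⁆ ≡ p
x∈p⇒p∪⁅x⁆≡p {p = inside ∷ p} here     = cong (inside ∷_) (∪-identityʳ p)
x∈p⇒p∪⁅x⁆≡p {p = s ∷ p} (there x∈p) = cong₂ _∷_ (∨-identityʳ s) (x∈p⇒p∪⁅x⁆≡p x∈p)

-- Greedy covering

prefixSum : (ℕ → ℕ) → ℕ → ℕ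
prefixSum f zero    = 0
prefixSum f (suc k) = prefixSum f k + f k

[a∸1]*N≤a*[N∸1] : ∀ {a N} → a ≤ N → (a ∸ 1) * N ≤ a * (N ∸ 1)
[a∸1]*N≤a*[N∸1] {a} {N} a≤N = begin
  (a ∸ 1) * N      ≡⟨ *-distribʳ-∸ N a 1 ⟩
  a * N ∸ 1 * N    ≤⟨ ∸-monoʳ-≤ (a * N) (≤-trans (≤-reflexive (*-comm a 1)) (*-monoʳ-≤ 1 a≤N)) ⟩
  a * N ∸ a * 1    ≡⟨ *-distribˡ-∸ a N 1 ⟨
  a * (N ∸ 1)      ∎
  where open ≤-Reasoning

bernoulli-∸ : ∀ N h → (N ∸ h) * N ^ h ≤ N * (N ∸ 1) ^ h
bernoulli-∸ N zero    = ≤-refl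
bernoulli-∸ N (suc h) = begin
  (N ∸ suc h) * (N * N ^ h)            ≡⟨ *-assoc (N ∸ suc h) N (N ^ h) ⟨
  (N ∸ suc h) * N * N ^ h              ≡⟨ cong (λ m → m * N * N ^ h) (pred[m∸n]≡m∸[1+n] N h) ⟨
  (N ∸ h ∸ 1) * N * N ^ h              ≤⟨ *-monoˡ-≤ (N ^ h) ([a∸1]*N≤a*[N∸1] (m∸n≤m N h)) ⟩
  (N ∸ h) * (N ∸ 1) * N ^ h            ≡⟨ xy∙z≈y∙xz (N ∸ h) (N ∸ 1) (N ^ h) ⟩
  (N ∸ 1) * ((N ∸ h) * N ^ h)          ≤⟨ *-monoʳ-≤ (N ∸ 1) (bernoulli-∸ N h) ⟩
  (N ∸ 1) * (N * (N ∸ 1) ^ h)          ≡⟨ x∙yz≈y∙xz (N ∸ 1) N ((N ∸ 1) ^ h) ⟩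
  N * ((N ∸ 1) * (N ∸ 1) ^ h)          ∎
  where open ≤-Reasoning

^-distribʳ-* : ∀ a b n → (a * b) ^ n ≡ a ^ n * b ^ n
^-distribʳ-* a b zero    = refl
^-distribʳ-* a b (suc n) = trans (cong (a * b *_) (^-distribʳ-* a b n)) (interchange a b (a ^ n) (b ^ n))

greedy-invariant-step : ∀ {N U U′ G h} .{{_ : NonZero N}} →
  U′ * N ≤ U * (N ∸ h) → U * N ^ G ≤ N * (N ∸ 1) ^ G →
  U′ * N ^ (G + h) ≤ N * (N ∸ 1) ^ (G + h)
greedy-invariant-step {N} {U} {U′} {G} {h} step inv = *-cancelʳ-≤ _ _ N (begin
  U′ * N ^ (G + h) * N                    ≡⟨ cong (λ m → U′ * m * N) (^-distribˡ-+-* N G h) ⟩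
  U′ * (N ^ G * N ^ h) * N                ≡⟨ xy∙z≈xz∙y U′ (N ^ G * N ^ h) N ⟩
  U′ * N * (N ^ G * N ^ h)                ≤⟨ *-monoˡ-≤ (N ^ G * N ^ h) step ⟩
  U * (N ∸ h) * (N ^ G * N ^ h)           ≡⟨ interchange U (N ∸ h) (N ^ G) (N ^ h) ⟩
  U * N ^ G * ((N ∸ h) * N ^ h)           ≤⟨ *-mono-≤ inv (bernoulli-∸ N h) ⟩
  N * (N ∸ 1) ^ G * (N * (N ∸ 1) ^ h)     ≡⟨ interchange N ((N ∸ 1) ^ G) N ((N ∸ 1) ^ h) ⟩
  N * N * ((N ∸ 1) ^ G * (N ∸ 1) ^ h)     ≡⟨ cong (N * N *_) (^-distribˡ-+-* (N ∸ 1) G h) ⟨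
  N * N * (N ∸ 1) ^ (G + h)               ≡⟨ xy∙z≈xz∙y N N ((N ∸ 1) ^ (G + h)) ⟩
  N * (N ∸ 1) ^ (G + h) * N               ∎)
  where open ≤-Reasoning

module Greedy
  {n : ℕ} (Bad : Subset n → Fin n → Set) (bad? : ∀ S → Decidable (Bad S))
  (bad-antitone : ∀ S x {P} → Bad (S ∪ ⁅ x ⁆) P → Bad S P)
  (g : ℕ → ℕ) (g>0 : ∀ j → 0 < g j)
  (fixers : ∀ S {P} → Bad S P → g ∣ S ∣ ≤ count (λ x → ¬? (bad? (S ∪ ⁅ x ⁆) P)))
  (N : ℕ) .{{_ : NonZero N}} (n≤N : n ≤ N)
  where

  badCount : Subset n → ℕ
  badCount S = count (bad? S)

  cured? : ∀ S x → Decidable (λ P → Bad S P × ¬ Bad (S ∪ ⁅ x ⁆) P)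
  cured? S x P = bad? S P ×-dec ¬? (bad? (S ∪ ⁅ x ⁆) P)

  badCount-∪ : ∀ S x → badCount S ≡ badCount (S ∪ ⁅ x ⁆) + count (cured? S x)
  badCount-∪ S x = trans (sum-cong-≗ split) (∑-distrib-+ (𝟙 ∘ bad? (S ∪ ⁅ x ⁆)) (𝟙 ∘ cured? S x))
    where
    split : ∀ P → 𝟙 (bad? S P) ≡ 𝟙 (bad? (S ∪ ⁅ x ⁆) P) + 𝟙 (cured? S x P)
    split P with bad? S P | bad? (S ∪ ⁅ x ⁆) P
    ... | yes _ | yes _   = refl
    ... | yes _ | no _    = refl
    ... | no ¬b | yes b∪x = ⊥-elim (¬b (bad-antitone S x b∪x))
    ... | no _  | no _    = refl

  ∑-cured : ∀ S → badCount S * g ∣ S ∣ ≤ ∑[ x < n ] count (cured? S x)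
  ∑-cured S = begin
    badCount S * g ∣ S ∣                     ≡⟨ *-distribʳ-sum (g ∣ S ∣) (𝟙 ∘ bad? S) ⟩
    ∑[ P < n ] (𝟙 (bad? S P) * g ∣ S ∣)      ≤⟨ ∑-mono-≤ atPoint ⟩
    ∑[ P < n ] ∑[ x < n ] 𝟙 (cured? S x P)   ≡⟨ ∑-comm (λ P x → 𝟙 (cured? S x P)) ⟩
    ∑[ x < n ] count (cured? S x)            ∎
    where
    open ≤-Reasoning
    atPoint : ∀ P → 𝟙 (bad? S P) * g ∣ S ∣ ≤ ∑[ x < n ] 𝟙 (cured? S x P)
    atPoint P with bad? S P
    ... | yes bad = ≤-trans (≤-reflexive (*-identityˡ (g ∣ S ∣))) (fixers S bad)
    ... | no _    = z≤n

  cured-∈ : ∀ S {x} → x ∈ S → count (cured? S x) ≡ 0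
  cured-∈ S x∈S = count-none (cured? S _) λ P (bad , ¬bad) →
    ¬bad (subst (λ T → Bad T P) (sym (x∈p⇒p∪⁅x⁆≡p x∈S)) bad)

  greedy-step : ∀ S → 0 < badCount S →
                ∃[ x ] (x ∉ S × badCount (S ∪ ⁅ x ⁆) * N ≤ badCount S * (N ∸ g ∣ S ∣))
  greedy-step S 0<bad = x , x∉S , bound
    where
    open ≤-Reasoning
    average = ∃-≥-average (count ∘ cured? S) (proj₁ (count-pos⇒∃ (bad? S) 0<bad))
    x = proj₁ average
    c = count (cured? S x)
    bad*g≤N*c : badCount S * g ∣ S ∣ ≤ N * c
    bad*g≤N*c = ≤-trans (∑-cured S) (≤-trans (proj₂ average) (*-monoˡ-≤ c n≤N))
    x∉S : x ∉ S
    x∉S x∈S = <⇒≱ (*-mono-≤ 0<bad (g>0 ∣ S ∣))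
                   (≤-trans bad*g≤N*c (≤-reflexive (trans (cong (N *_) (cured-∈ S x∈S)) (*-zeroʳ N))))
    bound : badCount (S ∪ ⁅ x ⁆) * N ≤ badCount S * (N ∸ g ∣ S ∣)
    bound = begin
      badCount (S ∪ ⁅ x ⁆) * N                ≡⟨ cong (_* N) (m+n∸n≡m (badCount (S ∪ ⁅ x ⁆)) c) ⟨
      (badCount (S ∪ ⁅ x ⁆) + c ∸ c) * N      ≡⟨ cong (λ m → (m ∸ c) * N) (badCount-∪ S x) ⟨
      (badCount S ∸ c) * N                    ≡⟨ *-distribʳ-∸ N (badCount S) c ⟩
      badCount S * N ∸ c * N                  ≤⟨ ∸-monoʳ-≤ (badCount S * N) (subst (badCount S * g ∣ S ∣ ≤_) (*-comm N c) bad*g≤N*c) ⟩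
      badCount S * N ∸ badCount S * g ∣ S ∣   ≡⟨ *-distribˡ-∸ (badCount S) N (g ∣ S ∣) ⟨
      badCount S * (N ∸ g ∣ S ∣)              ∎

  G : ℕ → ℕ
  G = prefixSum g

  -- bound is badCount set ≤ N (1 - 1/N)^(G k) with the denominators cleared
  record Stage (k : ℕ) : Set where
    field
      set   : Subset n
      size≤ : ∣ set ∣ ≤ k
      size≡ : 0 < badCount set → ∣ set ∣ ≡ k
      bound : badCount set * N ^ G k ≤ N * (N ∸ 1) ^ G k

  stage : ∀ k → Stage k
  stage zero = record
    { set   = ∅
    ; size≤ = ≤-reflexive (∣⊥∣≡0 n)
    ; size≡ = λ _ → ∣⊥∣≡0 n
    ; bound = *-monoˡ-≤ 1 (≤-trans (count≤n (bad? ∅)) n≤N)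
    }
  stage (suc k) = extend (stage k)
    where
    extend : Stage k → Stage (suc k)
    extend s with 0 <? badCount (Stage.set s)
    ... | no ¬0<bad = record
      { set   = set
      ; size≤ = m≤n⇒m≤1+n size≤
      ; size≡ = λ 0<bad → ⊥-elim (¬0<bad 0<bad)
      ; bound = ≤-trans (≤-reflexive (cong (_* N ^ G (suc k)) (n≤0⇒n≡0 (≮⇒≥ ¬0<bad)))) z≤n
      }
      where open Stage s
    ... | yes 0<bad = record
      { set   = set ∪ ⁅ x ⁆
      ; size≤ = ≤-reflexive size′
      ; size≡ = λ _ → size′
      ; bound = greedy-invariant-step {U = badCount set} {badCount (set ∪ ⁅ x ⁆)} {G k} step′ bound
      }
      where
      open Stage s
      x = proj₁ (greedy-step set 0<bad)
      x∉set = proj₁ (proj₂ (greedy-step set 0<bad))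
      step′ : badCount (set ∪ ⁅ x ⁆) * N ≤ badCount set * (N ∸ g k)
      step′ = subst (λ j → badCount (set ∪ ⁅ x ⁆) * N ≤ badCount set * (N ∸ g j)) (size≡ 0<bad)
                    (proj₂ (proj₂ (greedy-step set 0<bad)))
      size′ : ∣ set ∪ ⁅ x ⁆ ∣ ≡ suc k
      size′ = trans (∣p∪⁅x⁆∣≡1+∣p∣ set x∉set) (cong suc (size≡ 0<bad))

  greedy : ∀ k → N * (N ∸ 1) ^ G k < N ^ G k → ∃[ S ] (∣ S ∣ ≤ k × ∀ P → ¬ Bad S P)
  greedy k terminated = set , size≤ , λ P bad →
    <⇒≱ terminated (≤-trans (≤-reflexive (sym (*-identityˡ (N ^ G k))))
                    (≤-trans (*-monoˡ-≤ (N ^ G k) (1≤count (bad? set) bad)) bound))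
    where open Stage (stage k)

-- Projective planes

numPoints : ℕ → ℕ
numPoints q = suc (suc q * q)

-- An uncovered point P becomes covered by adding P itself or one of the q - 1 points other than
-- P and s on a line Ps with s ∈ S.
fixerBound : ℕ → ℕ → ℕ
fixerBound q j = suc ((q ∸ 1) * j)

-- N (1 - 1/N)^G < 1: the greedy bound leaves no uncovered point after k steps.
GreedyTerminatesBy : ℕ → ℕ → Set
GreedyTerminatesBy q k = N * (N ∸ 1) ^ G < N ^ G
  where
  N = numPoints q
  G = prefixSum (fixerBound q) k

all-equal⇒≤1 : ∀ {n} (a : Fin n) → (∀ x → x ≡ a) → n ≤ 1
all-equal⇒≤1 {suc zero}    _ _   = ≤-refl
all-equal⇒≤1 {suc (suc _)} _ all with trans (all zero) (sym (all (suc zero)))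
... | ()

module ProjectivePlane {q : ℕ} {Π : IncidenceStructure} (isPP : IsProjectivePlaneOfOrder q Π) where
  open IncidenceStructure Π using (_on_; Collinear)
  open IsProjectivePlaneOfOrder isPP

  Point : Set
  Point = Fin (v Π)

  on? : ∀ p ℓ → Dec (p on ℓ)
  on? p ℓ = T? (_I_ Π p ℓ)

  collinear? : ∀ x y z → Dec (Collinear x y z)
  collinear? x y z = any? λ ℓ → on? x ℓ ×-dec on? y ℓ ×-dec on? z ℓ

  count-on : ∀ ℓ → count (λ p → on? p ℓ) ≡ suc q
  count-on ℓ = trans (sym (length-filter-tabulate (λ p → on? p ℓ) id)) (order ℓ)

  collinear⇒on : ∀ {a c x ℓ} → a ≢ c → a on ℓ → c on ℓ → Collinear a c x → x on ℓ
  collinear⇒on {a} {c} {x} {ℓ} a≢c aℓ cℓ (m , am , cm , xm) =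
    subst (x on_) (joinUnique a c m ℓ a≢c am cm aℓ cℓ) xm

  module _ {a c : Point} (a≢c : a ≢ c) where

    private
      join = joinLine a c a≢c
      ℓ = proj₁ join
      aℓ = proj₁ (proj₂ join)
      cℓ = proj₂ (proj₂ join)

    count-collinear : count (collinear? a c) ≡ suc q
    count-collinear =
      trans (count-cong (collinear? a c) (λ x → on? x ℓ) (collinear⇒on a≢c aℓ cℓ) (λ xℓ → ℓ , aℓ , cℓ , xℓ))
            (count-on ℓ)

    count-collinear∖1 : count (λ x → collinear? a c x ×-dec ¬? (x ≟ a)) ≡ q
    count-collinear∖1 =
      suc-injective (trans (sym (count-remove (collinear? a c) (ℓ , aℓ , cℓ , aℓ))) count-collinear)

    count-collinear∖2 : count (λ x → (collinear? a c x ×-dec ¬? (x ≟ a)) ×-dec ¬? (x ≟ c)) ≡ q ∸ 1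
    count-collinear∖2 =
      cong pred (trans (sym (count-remove (λ x → collinear? a c x ×-dec ¬? (x ≟ a)) ((ℓ , aℓ , cℓ , cℓ) , a≢c ∘ sym)))
                       count-collinear∖1)

  v≤numPoints-antiflag : ∀ {P₀ ℓ} → ¬ P₀ on ℓ → v Π ≤ numPoints q
  v≤numPoints-antiflag {P₀} {ℓ} P₀∉ℓ = begin
    v Π
      ≡⟨ trans (∑-const (v Π) 1) (*-identityʳ (v Π)) ⟨
    ∑[ r < v Π ] 1
      ≤⟨ ∑-mono-≤ reached ⟩
    ∑[ r < v Π ] (𝟙 (r ≟ P₀) + count (λ t → projects? t r))
      ≡⟨ ∑-distrib-+ (𝟙 ∘ (_≟ P₀)) (λ r → count (λ t → projects? t r)) ⟩
    count (_≟ P₀) + ∑[ r < v Π ] ∑[ t < v Π ] 𝟙 (projects? t r)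
      ≡⟨ cong₂ _+_ (count-≟ P₀) (∑-comm λ r t → 𝟙 (projects? t r)) ⟩
    suc (∑[ t < v Π ] count (projects? t))
      ≡⟨ cong suc (sum-cong-≗ λ t → count-×ˡ (on? t ℓ) (line∖P₀? t)) ⟩
    suc (∑[ t < v Π ] (𝟙 (on? t ℓ) * count (line∖P₀? t)))
      ≡⟨ cong suc (∑-𝟙*-const (λ t → on? t ℓ) _ λ tℓ → count-collinear∖1 (P₀≢ tℓ)) ⟩
    suc (count (λ t → on? t ℓ) * q)
      ≡⟨ cong (λ m → suc (m * q)) (count-on ℓ) ⟩
    numPoints q
      ∎
    where
    open ≤-Reasoning
    line∖P₀? = λ t r → collinear? P₀ t r ×-dec ¬? (r ≟ P₀)
    projects? = λ t r → on? t ℓ ×-dec line∖P₀? t r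
    P₀≢ : ∀ {t} → t on ℓ → P₀ ≢ t
    P₀≢ tℓ refl = P₀∉ℓ tℓ
    reached : ∀ r → 1 ≤ 𝟙 (r ≟ P₀) + count (λ t → projects? t r)
    reached r = reached′ (r ≟ P₀)
      where
      reached′ : (r≟P₀ : Dec (r ≡ P₀)) → 1 ≤ 𝟙 r≟P₀ + count (λ t → projects? t r)
      reached′ (yes _)    = s≤s z≤n
      reached′ (no r≢P₀) =
        let L , P₀L , rL = joinLine P₀ r (r≢P₀ ∘ sym)
            t , tL , tℓ  = meetPoint L ℓ λ { refl → P₀∉ℓ P₀L }
        in 1≤count (λ t → projects? t r) (tℓ , (L , P₀L , tL , rL) , r≢P₀)

  v≤numPoints : v Π ≤ numPoints q
  v≤numPoints with quadrangle
  ... | p₁ , p₂ , p₃ , _ , ¬p₁p₂p₃ , _ with p₁ ≟ p₂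
  ...   | no p₁≢p₂ = let ℓ , p₁ℓ , p₂ℓ = joinLine p₁ p₂ p₁≢p₂ in
                     v≤numPoints-antiflag {p₃} λ p₃ℓ → ¬p₁p₂p₃ (ℓ , p₁ℓ , p₂ℓ , p₃ℓ)
  ...   | yes refl = ≤-trans (all-equal⇒≤1 p₁ all≡p₁) (s≤s z≤n)
    where
    p₃≡p₁ : p₃ ≡ p₁
    p₃≡p₁ = decidable-stable (p₃ ≟ p₁) λ p₃≢p₁ →
      let ℓ , p₁ℓ , p₃ℓ = joinLine p₁ p₃ (p₃≢p₁ ∘ sym) in ¬p₁p₂p₃ (ℓ , p₁ℓ , p₁ℓ , p₃ℓ)
    all≡p₁ : ∀ r → r ≡ p₁
    all≡p₁ r = decidable-stable (r ≟ p₁) λ r≢p₁ →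
      let ℓ , p₁ℓ , _ = joinLine p₁ r (r≢p₁ ∘ sym)
      in ¬p₁p₂p₃ (ℓ , p₁ℓ , p₁ℓ , subst (_on ℓ) (sym p₃≡p₁) p₁ℓ)

  Covered : Subset (v Π) → Point → Set
  Covered S p = Σ Point λ x → Σ Point λ y → x ≢ y × x ∈ S × y ∈ S × Collinear p x y

  covered? : ∀ S → Decidable (Covered S)
  covered? S p = any? λ x → any? λ y → ¬? (x ≟ y) ×-dec x ∈? S ×-dec y ∈? S ×-dec collinear? p x y

  Uncovered : Subset (v Π) → Point → Set
  Uncovered S p = p ∉ S × ¬ Covered S p

  uncovered? : ∀ S → Decidable (Uncovered S)
  uncovered? S p = ¬? (p ∈? S) ×-dec ¬? (covered? S p)

  uncovered-antitone : ∀ S x {p} → Uncovered (S ∪ ⁅ x ⁆) p → Uncovered S p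
  uncovered-antitone S x (p∉S∪x , ¬covered) = p∉S∪x ∘ p⊆p∪q ⁅ x ⁆ , ¬covered ∘ widen
    where
    widen : ∀ {p} → Covered S p → Covered (S ∪ ⁅ x ⁆) p
    widen (a , c , a≢c , a∈S , c∈S , col) = a , c , a≢c , p⊆p∪q ⁅ x ⁆ a∈S , p⊆p∪q ⁅ x ⁆ c∈S , col

  module _ (S : Subset (v Π)) {P : Point} (P-uncovered : Uncovered S P) where

    private
      P∉S = proj₁ P-uncovered
      ¬covered = proj₂ P-uncovered

    fixes? : Decidable (λ x → ¬ Uncovered (S ∪ ⁅ x ⁆) P)
    fixes? x = ¬? (uncovered? (S ∪ ⁅ x ⁆) P)

    through? : ∀ s x → Dec (s ∈ S × (Collinear P s x × x ≢ P) × x ≢ s)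
    through? s x = s ∈? S ×-dec ((collinear? P s x ×-dec ¬? (x ≟ P)) ×-dec ¬? (x ≟ s))

    through-unique : ∀ {x s s′} → s ∈ S × (Collinear P s x × x ≢ P) × x ≢ s →
                     s′ ∈ S × (Collinear P s′ x × x ≢ P) × x ≢ s′ → s ≡ s′
    through-unique {x} {s} {s′} (s∈S , ((ℓ , Pℓ , sℓ , xℓ) , x≢P) , _) (s′∈S , ((m , Pm , s′m , xm) , _) , _) =
      decidable-stable (s ≟ s′) λ s≢s′ → ¬covered (s , s′ , s≢s′ , s∈S , s′∈S , ℓ , Pℓ , sℓ , s′ℓ)
      where
      s′ℓ = subst (s′ on_) (joinUnique P x m ℓ (x≢P ∘ sym) Pm xm Pℓ xℓ) s′m

    through⇒fixes : ∀ {s x} → s ∈ S × (Collinear P s x × x ≢ P) × x ≢ s →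
                    ¬ Uncovered (S ∪ ⁅ x ⁆) P
    through⇒fixes {s} {x} (s∈S , ((ℓ , Pℓ , sℓ , xℓ) , _) , x≢s) (_ , ¬covered′) =
      ¬covered′ (x , s , x≢s , q⊆p∪q S ⁅ x ⁆ (x∈⁅x⁆ x) , p⊆p∪q ⁅ x ⁆ s∈S , ℓ , Pℓ , xℓ , sℓ)

    fixes-self : ¬ Uncovered (S ∪ ⁅ P ⁆) P
    fixes-self (P∉S∪P , _) = P∉S∪P (q⊆p∪q S ⁅ P ⁆ (x∈⁅x⁆ P))

    fixers-at : ∀ x → 𝟙 (x ≟ P) + count (λ s → through? s x) ≤ 𝟙 (fixes? x)
    fixers-at x = at (x ≟ P)
      where
      at : (x≟P : Dec (x ≡ P)) → 𝟙 x≟P + count (λ s → through? s x) ≤ 𝟙 (fixes? x)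
      at (yes refl) =
        ≤-reflexive (trans (cong suc (count-none (λ s → through? s P) λ _ (_ , (_ , P≢P) , _) → P≢P refl))
                           (sym (𝟙-yes (fixes? P) fixes-self)))
      at (no _)     = count≤𝟙 (λ s → through? s x) (fixes? x) through-unique through⇒fixes

    fixers : fixerBound q ∣ S ∣ ≤ count fixes?
    fixers = begin
      suc ((q ∸ 1) * ∣ S ∣)
        ≡⟨ cong suc (*-comm (q ∸ 1) ∣ S ∣) ⟩
      suc (∣ S ∣ * (q ∸ 1))
        ≡⟨ cong (λ m → suc (m * (q ∸ 1))) (∣p∣≡count∈ S) ⟩
      suc (count (_∈? S) * (q ∸ 1))
        ≡⟨ cong₂ _+_ (count-≟ P) (∑-𝟙*-const (_∈? S) _ on-line) ⟨
      count (_≟ P) + ∑[ s < v Π ] (𝟙 (s ∈? S) * count (line∖Ps? s))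
        ≡⟨ cong (count (_≟ P) +_) (sum-cong-≗ λ s → count-×ˡ (s ∈? S) (line∖Ps? s)) ⟨
      count (_≟ P) + ∑[ s < v Π ] ∑[ x < v Π ] 𝟙 (through? s x)
        ≡⟨ cong (count (_≟ P) +_) (∑-comm λ s x → 𝟙 (through? s x)) ⟩
      count (_≟ P) + ∑[ x < v Π ] count (λ s → through? s x)
        ≡⟨ ∑-distrib-+ (𝟙 ∘ (_≟ P)) (λ x → count (λ s → through? s x)) ⟨
      ∑[ x < v Π ] (𝟙 (x ≟ P) + count (λ s → through? s x))
        ≤⟨ ∑-mono-≤ fixers-at ⟩
      count fixes?
        ∎
      where
      open ≤-Reasoning
      line∖Ps? = λ s x → (collinear? P s x ×-dec ¬? (x ≟ P)) ×-dec ¬? (x ≟ s)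
      on-line : ∀ {s} → s ∈ S → count (line∖Ps? s) ≡ q ∸ 1
      on-line s∈S = count-collinear∖2 λ { refl → P∉S s∈S }

  saturating-set : ∀ {k} → GreedyTerminatesBy q k → ∃[ S ] (Saturating Π S × ∣ S ∣ ≤ k)
  saturating-set {k} terminated =
    let S , size≤ , none-uncovered = greedy k terminated
    in S , (λ p p∉S → decidable-stable (covered? S p) λ ¬covered → none-uncovered p (p∉S , ¬covered)) , size≤
    where
    open Greedy Uncovered uncovered? uncovered-antitone (fixerBound q) (λ _ → s≤s z≤n) fixers
                (numPoints q) v≤numPoints

-- Partial sums of the exponential series

-- n! · expPartial M n
expPartialℕ : ℕ → ℕ → ℕ
expPartialℕ M zero    = 1
expPartialℕ M (suc n) = suc n * expPartialℕ M n + M ^ suc n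

expPartialℕ-mono : ∀ {M M′} n → M ≤ M′ → expPartialℕ M n ≤ expPartialℕ M′ n
expPartialℕ-mono zero    _    = ≤-refl
expPartialℕ-mono (suc n) M≤M′ =
  +-mono-≤ (*-monoʳ-≤ (suc n) (expPartialℕ-mono n M≤M′)) (^-monoˡ-≤ (suc n) M≤M′)

-- a / d for d ≠ 0
frac : ℕ → ℕ → ℚᵘ
frac a d = mkℚᵘ (ℤ.+ a) (pred d)

toℚᵘ-/ : ∀ a d .{{_ : NonZero d}} → toℚᵘ (ℤ.+ a ℚ./ d) ℚᵘ.≃ frac a d
toℚᵘ-/ a (suc d) = toℚᵘ-fromℚᵘ (frac a (suc d))

frac-≤ : ∀ {a b} d e .{{_ : NonZero d}} .{{_ : NonZero e}} → a * e ≤ b * d → frac a d ℚᵘ.≤ frac b e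
frac-≤ {a} {b} (suc d) (suc e) ae≤bd = *≤* (subst₂ ℤ._≤_ (pos-* a (suc e)) (pos-* b (suc d)) (ℤ.+≤+ ae≤bd))

frac-≃ : ∀ {a b} d e .{{_ : NonZero d}} .{{_ : NonZero e}} → a * e ≡ b * d → frac a d ℚᵘ.≃ frac b e
frac-≃ {a} {b} (suc d) (suc e) ae≡bd =
  *≡* (trans (sym (pos-* a (suc e))) (trans (cong ℤ.+_ ae≡bd) (pos-* b (suc d))))

frac-+ : ∀ a b d e .{{_ : NonZero d}} .{{_ : NonZero e}} →
         frac a d ℚᵘ.+ frac b e ℚᵘ.≃ frac (a * e + b * d) (d * e)
frac-+ a b (suc d) (suc e) = ℚᵘ.≃-reflexive (cong (λ z → mkℚᵘ z (pred (suc d * suc e)))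
  (sym (trans (pos-+ (a * suc e) (b * suc d)) (cong₂ ℤ._+_ (pos-* a (suc e)) (pos-* b (suc d))))))

expPartial≃ : ∀ M n → toℚᵘ (expPartial M n) ℚᵘ.≃ frac (expPartialℕ M n) (n !)
expPartial≃ M zero    = toℚᵘ-/ 1 1
expPartial≃ M (suc n) = begin-equality
  toℚᵘ (expPartial M n ℚ.+ term)                  ≃⟨ toℚᵘ-homo-+ (expPartial M n) term ⟩
  toℚᵘ (expPartial M n) ℚᵘ.+ toℚᵘ term             ≃⟨ ℚᵘ.+-cong (expPartial≃ M n) (toℚᵘ-/ (M ^ suc n) (suc n !)) ⟩
  frac a (n !) ℚᵘ.+ frac (M ^ suc n) (suc n !)     ≃⟨ frac-+ a (M ^ suc n) (n !) (suc n !) ⟩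
  frac (a * suc n ! + M ^ suc n * n !) (n ! * suc n !) ≃⟨ frac-≃ (n ! * suc n !) (suc n !) cross ⟩
  frac (expPartialℕ M (suc n)) (suc n !)           ∎
  where
  open ℚᵘ.≤-Reasoning
  instance
    _ = n !≢0
    _ = suc n !≢0
    _ = n !* suc n !≢0
  a = expPartialℕ M n
  term = ℤ.+ (M ^ suc n) ℚ./ suc n !
  cross : (a * suc n ! + M ^ suc n * n !) * suc n ! ≡ (suc n * a + M ^ suc n) * (n ! * suc n !)
  cross = identity a (M ^ suc n) (n !) n
    where
    identity : ∀ a m f s → (a * (f + s * f) + m * f) * (f + s * f) ≡ (suc s * a + m) * (f * (f + s * f))
    identity = solve-∀

ExpLe⇐expPartialℕ : ∀ {M Y} → (∀ n → expPartialℕ M n ≤ n ! * Y) → ExpLe M Y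
ExpLe⇐expPartialℕ {M} {Y} bound n = toℚᵘ-cancel-≤ (begin
  toℚᵘ (expPartial M n)       ≃⟨ expPartial≃ M n ⟩
  frac (expPartialℕ M n) (n !) ≤⟨ frac-≤ (n !) 1 {{n !≢0}} (subst₂ _≤_ (sym (*-identityʳ _)) (*-comm (n !) Y) (bound n)) ⟩
  frac Y 1                     ≃⟨ toℚᵘ-/ Y 1 ⟨
  toℚᵘ (ℤ.+ Y ℚ./ 1)             ∎)
  where open ℚᵘ.≤-Reasoning

ExpLe-antitone : ∀ {M M′ Y} → M ≤ M′ → ExpLe M′ Y → ExpLe M Y
ExpLe-antitone {M} {M′} M≤M′ e^M′≤Y n = ℚ-≤-trans (toℚᵘ-cancel-≤ (begin
  toℚᵘ (expPartial M n)         ≃⟨ expPartial≃ M n ⟩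
  frac (expPartialℕ M n) (n !)  ≤⟨ frac-≤ (n !) (n !) {{n !≢0}} {{n !≢0}} (*-monoˡ-≤ (n !) (expPartialℕ-mono n M≤M′)) ⟩
  frac (expPartialℕ M′ n) (n !) ≃⟨ expPartial≃ M′ n ⟨
  toℚᵘ (expPartial M′ n)        ∎)) (e^M′≤Y n)
  where open ℚᵘ.≤-Reasoning

BoundHolds-antitone : ∀ {s k X} → s ≤ k → BoundHolds k X → BoundHolds s X
BoundHolds-antitone s≤k (inj₁ k≤2) = inj₁ (≤-trans s≤k k≤2)
BoundHolds-antitone {X = X} s≤k (inj₂ e^M≤Y) =
  inj₂ (ExpLe-antitone {Y = X ^ (4 * X)} (^-monoˡ-≤ 2 (∸-monoˡ-≤ 2 s≤k)) e^M≤Y)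

rising : ℕ → ℕ → ℕ
rising K zero    = 1
rising K (suc i) = rising K i * (K + i)

rising-suc : ∀ K n → rising K (suc n) ≡ K * rising (suc K) n
rising-suc K zero    = trans (*-identityˡ (K + 0)) (trans (+-identityʳ K) (sym (*-identityʳ K)))
rising-suc K (suc n) = begin
  rising K (suc n) * (K + suc n)       ≡⟨ cong (_* (K + suc n)) (rising-suc K n) ⟩
  K * rising (suc K) n * (K + suc n)   ≡⟨ *-assoc K (rising (suc K) n) (K + suc n) ⟩
  K * (rising (suc K) n * (K + suc n)) ≡⟨ cong (λ m → K * (rising (suc K) n * m)) (+-suc K n) ⟩
  K * (rising (suc K) n * (suc K + n)) ∎
  where open ≡-Reasoning

^≤rising : ∀ K i → K ^ i ≤ rising K i
^≤rising K zero    = ≤-refl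
^≤rising K (suc i) = ≤-trans (≤-reflexive (*-comm K (K ^ i))) (*-mono-≤ (^≤rising K i) (m≤m+n K i))

-- n! (R+1)ⁿ times the n-th partial sum of (1 - 1/(R+1))^(-K) = Σⱼ rising K j / (j! (R+1)ʲ). For
-- K = (R+1) M its terms dominate those of e^M, whence e^M ≤ ((R+1)/R)^((R+1) M).
negBinomialPartial : ℕ → ℕ → ℕ → ℕ
negBinomialPartial R K zero    = 1
negBinomialPartial R K (suc n) = suc n * suc R * negBinomialPartial R K n + rising K (suc n)

negBinomialPartial-recurrence : ∀ R K n →
  R * negBinomialPartial R (suc K) n + rising (suc K) n ≡ suc R * negBinomialPartial R K n
negBinomialPartial-recurrence R K zero    = base R
  where
  base : ∀ R → R * 1 + 1 ≡ suc R * 1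
  base = solve-∀
negBinomialPartial-recurrence R K (suc n) = +-cancelʳ-≡ _ _ _ (begin
  R * (suc n * suc R * T′ + x * (suc K + n)) + x * (suc K + n) + suc n * suc R * x
    ≡⟨ identity₁ R n K T′ x ⟩
  suc n * suc R * (R * T′ + x) + suc R * x * (suc K + n)
    ≡⟨ cong (λ m → suc n * suc R * m + suc R * x * (suc K + n)) IH ⟩
  suc n * suc R * (suc R * T) + suc R * x * (suc K + n)
    ≡⟨ identity₂ R n K T x ⟩
  suc R * (suc n * suc R * T + K * x) + suc n * suc R * x
    ≡⟨ cong (λ m → suc R * (suc n * suc R * T + m) + suc n * suc R * x) (rising-suc K n) ⟨
  suc R * negBinomialPartial R K (suc n) + suc n * suc R * x ∎)
  where
  open ≡-Reasoning
  T′ = negBinomialPartial R (suc K) n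
  T  = negBinomialPartial R K n
  x  = rising (suc K) n
  IH = negBinomialPartial-recurrence R K n
  identity₁ : ∀ R n K T′ x → R * (suc n * suc R * T′ + x * (suc K + n)) + x * (suc K + n) + suc n * suc R * x
                              ≡ suc n * suc R * (R * T′ + x) + suc R * x * (suc K + n)
  identity₁ = solve-∀
  identity₂ : ∀ R n K T x → suc n * suc R * (suc R * T) + suc R * x * (suc K + n)
                            ≡ suc R * (suc n * suc R * T + K * x) + suc n * suc R * x
  identity₂ = solve-∀

negBinomialPartial-zero : ∀ R n → negBinomialPartial R 0 n ≡ n ! * suc R ^ n
negBinomialPartial-zero R zero    = refl
negBinomialPartial-zero R (suc n) = begin
  suc n * suc R * negBinomialPartial R 0 n + rising 0 (suc n)
    ≡⟨ cong₂ (λ a b → suc n * suc R * a + b) (negBinomialPartial-zero R n) (rising-suc 0 n) ⟩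
  suc n * suc R * (n ! * suc R ^ n) + 0
    ≡⟨ identity n R (n !) (suc R ^ n) ⟩
  suc n * n ! * (suc R * suc R ^ n) ∎
  where
  open ≡-Reasoning
  identity : ∀ n R f p → suc n * suc R * (f * p) + 0 ≡ suc n * f * (suc R * p)
  identity = solve-∀

negBinomialPartial-bound : ∀ R K n → R ^ K * negBinomialPartial R K n ≤ suc R ^ K * (n ! * suc R ^ n)
negBinomialPartial-bound R zero    n = ≤-reflexive (cong (1 *_) (negBinomialPartial-zero R n))
negBinomialPartial-bound R (suc K) n = begin
  R * R ^ K * T′                      ≡⟨ xy∙z≈y∙xz R (R ^ K) T′ ⟩
  R ^ K * (R * T′)                    ≤⟨ *-monoʳ-≤ (R ^ K) (m≤m+n (R * T′) (rising (suc K) n)) ⟩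
  R ^ K * (R * T′ + rising (suc K) n) ≡⟨ cong (R ^ K *_) (negBinomialPartial-recurrence R K n) ⟩
  R ^ K * (suc R * T)                 ≡⟨ x∙yz≈y∙xz (R ^ K) (suc R) T ⟩
  suc R * (R ^ K * T)                 ≤⟨ *-monoʳ-≤ (suc R) (negBinomialPartial-bound R K n) ⟩
  suc R * (suc R ^ K * (n ! * suc R ^ n)) ≡⟨ *-assoc (suc R) (suc R ^ K) (n ! * suc R ^ n) ⟨
  suc R * suc R ^ K * (n ! * suc R ^ n) ∎
  where
  open ≤-Reasoning
  T′ = negBinomialPartial R (suc K) n
  T  = negBinomialPartial R K n

expPartialℕ≤negBinomialPartial : ∀ R M n →
                                 suc R ^ n * expPartialℕ M n ≤ negBinomialPartial R (suc R * M) n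
expPartialℕ≤negBinomialPartial R M zero    = ≤-refl
expPartialℕ≤negBinomialPartial R M (suc n) = begin
  suc R * suc R ^ n * (suc n * expPartialℕ M n + M ^ suc n)
    ≡⟨ identity R (suc R ^ n) n (expPartialℕ M n) (M ^ suc n) ⟩
  suc n * suc R * (suc R ^ n * expPartialℕ M n) + suc R ^ suc n * M ^ suc n
    ≡⟨ cong (suc n * suc R * (suc R ^ n * expPartialℕ M n) +_) (^-distribʳ-* (suc R) M (suc n)) ⟨
  suc n * suc R * (suc R ^ n * expPartialℕ M n) + (suc R * M) ^ suc n
    ≤⟨ +-mono-≤ (*-monoʳ-≤ (suc n * suc R) (expPartialℕ≤negBinomialPartial R M n))
                (^≤rising (suc R * M) (suc n)) ⟩
  negBinomialPartial R (suc R * M) (suc n) ∎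
  where
  open ≤-Reasoning
  identity : ∀ R p n a m → suc R * p * (suc n * a + m) ≡ suc n * suc R * (p * a) + suc R * p * m
  identity = solve-∀

expPartialℕ-bound : ∀ {R M Y} .{{_ : NonZero R}} → suc R ^ (suc R * M) ≤ Y * R ^ (suc R * M) →
                    ∀ n → expPartialℕ M n ≤ n ! * Y
expPartialℕ-bound {R} {M} {Y} compound n =
  *-cancelˡ-≤ P {{m^n≢0 (suc R) n}} (*-cancelʳ-≤ _ _ Q {{m^n≢0 R K}} (begin
    P * expPartialℕ M n * Q               ≡⟨ *-comm (P * expPartialℕ M n) Q ⟩
    Q * (P * expPartialℕ M n)             ≤⟨ *-monoʳ-≤ Q (expPartialℕ≤negBinomialPartial R M n) ⟩
    Q * negBinomialPartial R K n          ≤⟨ negBinomialPartial-bound R K n ⟩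
    suc R ^ K * (n ! * P)                 ≤⟨ *-monoˡ-≤ (n ! * P) compound ⟩
    Y * Q * (n ! * P)                     ≡⟨ identity Y Q (n !) P ⟩
    P * (n ! * Y) * Q                     ∎))
  where
  open ≤-Reasoning
  K = suc R * M
  P = suc R ^ n
  Q = R ^ K
  identity : ∀ y q f p → y * q * (f * p) ≡ p * (f * y) * q
  identity = solve-∀

compound⇒ExpLe : ∀ R M Y .{{_ : NonZero R}} → suc R ^ (suc R * M) ≤ Y * R ^ (suc R * M) →
                 ExpLe M Y
compound⇒ExpLe R M Y compound = ExpLe⇐expPartialℕ {Y = Y} (expPartialℕ-bound compound)

-- Numerical estimates

bernoulli : ∀ R n → R ^ n * (R + n) ≤ suc R ^ n * R
bernoulli R zero    = ≤-reflexive (cong (1 *_) (+-identityʳ R))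
bernoulli R (suc n) = begin
  R * R ^ n * (R + suc n)            ≤⟨ m≤m+n _ (R ^ n * n) ⟩
  R * R ^ n * (R + suc n) + R ^ n * n ≡⟨ identity R (R ^ n) n ⟩
  suc R * (R ^ n * (R + n))          ≤⟨ *-monoʳ-≤ (suc R) (bernoulli R n) ⟩
  suc R * (suc R ^ n * R)            ≡⟨ *-assoc (suc R) (suc R ^ n) R ⟨
  suc R * suc R ^ n * R              ∎
  where
  open ≤-Reasoning
  identity : ∀ R p n → R * p * (R + suc n) + p * n ≡ suc R * (p * (R + n))
  identity = solve-∀

^-ratio-mono : ∀ {A B a b} → B ≤ A → a ≤ b → A ^ a * B ^ b ≤ A ^ b * B ^ a
^-ratio-mono {A} {B} {a} {b} B≤A a≤b = begin
  A ^ a * B ^ b                ≡⟨ cong (λ e → A ^ a * B ^ e) (m+[n∸m]≡n a≤b) ⟨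
  A ^ a * B ^ (a + d)          ≡⟨ cong (A ^ a *_) (^-distribˡ-+-* B a d) ⟩
  A ^ a * (B ^ a * B ^ d)      ≤⟨ *-monoʳ-≤ (A ^ a) (*-monoʳ-≤ (B ^ a) (^-monoˡ-≤ d B≤A)) ⟩
  A ^ a * (B ^ a * A ^ d)      ≡⟨ x∙yz≈xz∙y (A ^ a) (B ^ a) (A ^ d) ⟩
  A ^ a * A ^ d * B ^ a        ≡⟨ cong (_* B ^ a) (^-distribˡ-+-* A a d) ⟨
  A ^ (a + d) * B ^ a          ≡⟨ cong (λ e → A ^ e * B ^ a) (m+[n∸m]≡n a≤b) ⟩
  A ^ b * B ^ a                ∎
  where
  open ≤-Reasoning
  d = b ∸ a

transition : ∀ {P : ℕ → Set} → Decidable P → ¬ P 0 → ∀ d → P d → ∃[ j ] (j < d × ¬ P j × P (suc j))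
transition P? ¬P₀ zero    P₀ = ⊥-elim (¬P₀ P₀)
transition P? ¬P₀ (suc d) Pd with P? d
... | no ¬Pd = d , n<1+n d , ¬Pd , Pd
... | yes Pd′ with transition P? ¬P₀ d Pd′
...   | j , j<d , ¬Pj , Pj+1 = j , m<n⇒m<1+n j<d , ¬Pj , Pj+1

greedyTerminatesBy? : ∀ q k → Dec (GreedyTerminatesBy q k)
greedyTerminatesBy? q k = _ <? _

numPoints≤square : ∀ q → numPoints q ≤ suc q * suc q
numPoints≤square q = s≤s (+-monoʳ-≤ q (*-monoʳ-≤ q (n≤1+n q)))

2*prefixSum-fixerBound : ∀ q m →
                         2 * prefixSum (fixerBound q) (suc m) ≡ (q ∸ 1) * (suc m * m) + 2 * suc m
2*prefixSum-fixerBound q zero    = base (q ∸ 1)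
  where
  base : ∀ p → 2 * (0 + suc (p * 0)) ≡ p * (1 * 0) + 2 * 1
  base = solve-∀
2*prefixSum-fixerBound q (suc m) = begin
  2 * (prefixSum (fixerBound q) (suc m) + fixerBound q (suc m))   ≡⟨ *-distribˡ-+ 2 (prefixSum (fixerBound q) (suc m)) _ ⟩
  2 * prefixSum (fixerBound q) (suc m) + 2 * fixerBound q (suc m) ≡⟨ cong (_+ 2 * fixerBound q (suc m)) (2*prefixSum-fixerBound q m) ⟩
  (q ∸ 1) * (suc m * m) + 2 * suc m + 2 * suc ((q ∸ 1) * suc m)   ≡⟨ identity (q ∸ 1) m ⟩
  (q ∸ 1) * (suc (suc m) * suc m) + 2 * suc (suc m)               ∎
  where
  open ≡-Reasoning
  identity : ∀ p m → p * (suc m * m) + 2 * suc m + 2 * suc (p * suc m)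
                     ≡ p * (suc (suc m) * suc m) + 2 * suc (suc m)
  identity = solve-∀

¬greedyTerminatesBy-1 : ∀ p → ¬ GreedyTerminatesBy (suc p) 1
¬greedyTerminatesBy-1 p terminated =
  <⇒≱ terminated′ (*-monoʳ-≤ N (≤-trans (s≤s z≤n) (m≤m*n (N ∸ 1) 1)))
  where
  N = numPoints (suc p)
  terminated′ : N * (N ∸ 1) ^ 1 < N ^ 1
  terminated′ = subst (λ G → N * (N ∸ 1) ^ G < N ^ G) (cong suc (*-zeroʳ p)) terminated

numPoints*j²-bound : ∀ p j → j ≤ suc p →
             numPoints (suc p) * j ^ 2 ≤ prefixSum (fixerBound (suc p)) (suc j) * (2 * suc (suc p))
numPoints*j²-bound p j j≤q = begin
  numPoints (suc p) * j ^ 2                     ≡⟨ identity₁ p j ⟩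
  a * (j * j) + (p + 3) * j * j                 ≤⟨ +-monoʳ-≤ (a * (j * j)) (*-monoʳ-≤ ((p + 3) * j) j≤q) ⟩
  a * (j * j) + (p + 3) * j * suc p             ≡⟨ cong (a * (j * j) +_) (identity₂ p j) ⟩
  a * (j * j) + (a * j + (2 * p + 3) * j)       ≤⟨ +-monoʳ-≤ (a * (j * j)) (+-monoʳ-≤ (a * j) 2p+3≤) ⟩
  a * (j * j) + (a * j + (2 * p + 4) * suc j)   ≡⟨ identity₃ p j ⟩
  (p * (suc j * j) + 2 * suc j) * suc (suc p)   ≡⟨ cong (_* suc (suc p)) (2*prefixSum-fixerBound (suc p) j) ⟨
  2 * G * suc (suc p)                           ≡⟨ xy∙z≈y∙xz 2 G (suc (suc p)) ⟩
  G * (2 * suc (suc p))                         ∎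
  where
  open ≤-Reasoning
  a = p * p + 2 * p
  G = prefixSum (fixerBound (suc p)) (suc j)
  2p+3≤ : (2 * p + 3) * j ≤ (2 * p + 4) * suc j
  2p+3≤ = *-mono-≤ (+-monoʳ-≤ (2 * p) (n≤1+n 3)) (n≤1+n j)
  identity₁ : ∀ p j → suc (suc (suc p) * suc p) * (j * (j * 1)) ≡ (p * p + 2 * p) * (j * j) + (p + 3) * j * j
  identity₁ = solve-∀
  identity₂ : ∀ p j → (p + 3) * j * suc p ≡ (p * p + 2 * p) * j + (2 * p + 3) * j
  identity₂ = solve-∀
  identity₃ : ∀ p j → (p * p + 2 * p) * (j * j) + ((p * p + 2 * p) * j + (2 * p + 4) * suc j)
                      ≡ (p * (suc j * j) + 2 * suc j) * suc (suc p)
  identity₃ = solve-∀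

-- Failure at j + 1 reads (N/B)^G ≤ N; raised to the power 2X and combined with N j² ≤ 2XG and
-- N ≤ X², it gives (N/B)^(N j²) ≤ X^(4X).
BoundHolds-at-transition : ∀ p j → j ≤ suc p → ¬ GreedyTerminatesBy (suc p) (suc j) →
                           BoundHolds (2 + j) (2 + p)
BoundHolds-at-transition p j j≤q not-terminated = inj₂ (compound⇒ExpLe B (j ^ 2) (X ^ (4 * X)) compound)
  where
  open ≤-Reasoning
  N = numPoints (suc p)
  B = N ∸ 1
  X = suc (suc p)
  G = prefixSum (fixerBound (suc p)) (suc j)
  E = G * (2 * X)
  N^E≤ : N ^ E ≤ N ^ (2 * X) * B ^ E
  N^E≤ = begin
    N ^ (G * (2 * X))                ≡⟨ ^-*-assoc N G (2 * X) ⟨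
    (N ^ G) ^ (2 * X)                ≤⟨ ^-monoˡ-≤ (2 * X) (≮⇒≥ not-terminated) ⟩
    (N * B ^ G) ^ (2 * X)            ≡⟨ ^-distribʳ-* N (B ^ G) (2 * X) ⟩
    N ^ (2 * X) * (B ^ G) ^ (2 * X)  ≡⟨ cong (N ^ (2 * X) *_) (^-*-assoc B G (2 * X)) ⟩
    N ^ (2 * X) * B ^ E              ∎
  N^2X≤X^4X : N ^ (2 * X) ≤ X ^ (4 * X)
  N^2X≤X^4X = begin
    N ^ (2 * X)            ≤⟨ ^-monoˡ-≤ (2 * X) (subst (N ≤_) (cong (X *_) (sym (*-identityʳ X))) (numPoints≤square (suc p))) ⟩
    (X ^ 2) ^ (2 * X)      ≡⟨ ^-*-assoc X 2 (2 * X) ⟩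
    X ^ (2 * (2 * X))      ≡⟨ cong (X ^_) (*-assoc 2 2 X) ⟨
    X ^ (4 * X)            ∎
  compound : N ^ (N * j ^ 2) ≤ X ^ (4 * X) * B ^ (N * j ^ 2)
  compound = *-cancelʳ-≤ _ _ (B ^ E) {{m^n≢0 B E}} (begin
    N ^ (N * j ^ 2) * B ^ E                ≤⟨ ^-ratio-mono (n≤1+n B) (numPoints*j²-bound p j j≤q) ⟩
    N ^ E * B ^ (N * j ^ 2)                ≤⟨ *-monoˡ-≤ (B ^ (N * j ^ 2)) N^E≤ ⟩
    N ^ (2 * X) * B ^ E * B ^ (N * j ^ 2)  ≤⟨ *-monoˡ-≤ (B ^ (N * j ^ 2)) (*-monoˡ-≤ (B ^ E) N^2X≤X^4X) ⟩
    X ^ (4 * X) * B ^ E * B ^ (N * j ^ 2)  ≡⟨ xy∙z≈xz∙y (X ^ (4 * X)) (B ^ E) (B ^ (N * j ^ 2)) ⟩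
    X ^ (4 * X) * B ^ (N * j ^ 2) * B ^ E  ∎)

⌊n/2⌋-bounds : ∀ n → ⌊ n /2⌋ + ⌊ n /2⌋ ≤ n × n ≤ suc (⌊ n /2⌋ + ⌊ n /2⌋)
⌊n/2⌋-bounds zero          = z≤n , z≤n
⌊n/2⌋-bounds (suc zero)    = z≤n , s≤s z≤n
⌊n/2⌋-bounds (suc (suc n)) with ⌊n/2⌋-bounds n
... | lower , upper = ≤-trans (≤-reflexive (cong suc (+-suc h h))) (s≤s (s≤s lower))
                    , ≤-trans (s≤s (s≤s upper)) (≤-reflexive (cong (2 +_) (sym (+-suc h h))))
  where h = ⌊ n /2⌋

square<2^ : ∀ {c} → 9 ≤ c → (2 + (c + c)) * (2 + (c + c)) < 2 ^ c
square<2^ 9≤c with m≤n⇒m<n∨m≡n 9≤c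
... | inj₂ refl = <ᵇ⇒< _ _ tt
... | inj₁ (s≤s 9≤c) = ≤-<-trans (step (≤-trans (s≤s (s≤s z≤n)) 9≤c)) (*-monoʳ-< 2 (square<2^ 9≤c))
  where
  identity : ∀ c → (2 + (suc c + suc c)) * (2 + (suc c + suc c)) + 4 * (c * c)
                   ≡ 2 * ((2 + (c + c)) * (2 + (c + c))) + 8
  identity = solve-∀
  step : ∀ {c} → 2 ≤ c → (2 + (suc c + suc c)) * (2 + (suc c + suc c)) ≤ 2 * ((2 + (c + c)) * (2 + (c + c)))
  step {c} 2≤c = +-cancelʳ-≤ 8 _ _ (≤-trans (+-monoʳ-≤ _ (*-monoʳ-≤ 4 (*-mono-≤ 2≤c (≤-trans (s≤s z≤n) 2≤c))))
                                           (≤-reflexive (identity c)))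

suc[q]*q*q≤2*prefixSum : ∀ q → suc q * q * q ≤ 2 * prefixSum (fixerBound q) (2 + q)
suc[q]*q*q≤2*prefixSum zero            = z≤n
suc[q]*q*q≤2*prefixSum (suc zero)      = ≤ᵇ⇒≤ _ _ tt
suc[q]*q*q≤2*prefixSum q@(suc (suc r)) = begin
  suc q * q * q                                                ≤⟨ m≤m+n _ (r * (3 + r) + 2 * (4 + r)) ⟩
  suc q * q * q + (r * (3 + r) + 2 * (4 + r))                  ≡⟨ identity r ⟩
  (q ∸ 1) * (suc (suc q) * suc q) + 2 * suc (suc q)            ≡⟨ 2*prefixSum-fixerBound q (suc q) ⟨
  2 * prefixSum (fixerBound q) (2 + q)                         ∎
  where
  open ≤-Reasoning
  identity : ∀ r → (3 + r) * (2 + r) * (2 + r) + (r * (3 + r) + 2 * (4 + r))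
                   ≡ suc r * ((4 + r) * (3 + r)) + 2 * (4 + r)
  identity = solve-∀

-- (1 + 1/B)^B ≥ 2 and B ⌊q/2⌋ ≤ G give (N/B)^G ≥ 2^⌊q/2⌋ > N.
greedyTerminates-large : ∀ q → 18 ≤ q → GreedyTerminatesBy q (2 + q)
greedyTerminates-large q@(suc _) 18≤q = *-cancelʳ-< (B ^ (B * c)) _ _ (begin-strict
  N * B ^ G * B ^ (B * c)        ≡⟨ *-assoc N (B ^ G) (B ^ (B * c)) ⟩
  N * (B ^ G * B ^ (B * c))      <⟨ *-monoˡ-< (B ^ G * B ^ (B * c)) N<2^c ⟩
  2 ^ c * (B ^ G * B ^ (B * c))  ≡⟨ x∙yz≈xz∙y (2 ^ c) (B ^ G) (B ^ (B * c)) ⟩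
  2 ^ c * B ^ (B * c) * B ^ G    ≤⟨ *-monoˡ-≤ (B ^ G) 2^c*B^Bc≤N^Bc ⟩
  N ^ (B * c) * B ^ G            ≤⟨ ^-ratio-mono (n≤1+n B) Bc≤G ⟩
  N ^ G * B ^ (B * c)            ∎)
  where
  open ≤-Reasoning
  N = numPoints q
  B = N ∸ 1
  G = prefixSum (fixerBound q) (2 + q)
  c = ⌊ q /2⌋
  instance
    _ = m*n≢0 (B ^ G) (B ^ (B * c)) {{m^n≢0 B G}} {{m^n≢0 B (B * c)}}
  c+c≤q = proj₁ (⌊n/2⌋-bounds q)
  q≤1+c+c = proj₂ (⌊n/2⌋-bounds q)
  9≤c : 9 ≤ c
  9≤c = ≮⇒≥ λ c<9 → <⇒≱ (s≤s (s≤s (+-mono-≤ (≤-pred c<9) (≤-pred c<9)))) (≤-trans 18≤q q≤1+c+c)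
  N<2^c : N < 2 ^ c
  N<2^c = ≤-<-trans (≤-trans (numPoints≤square q) (*-mono-≤ (s≤s q≤1+c+c) (s≤s q≤1+c+c))) (square<2^ 9≤c)
  Bc≤G : B * c ≤ G
  Bc≤G = *-cancelˡ-≤ 2 (begin
    2 * (B * c)   ≡⟨ identity B c ⟩
    B * (c + c)   ≤⟨ *-monoʳ-≤ B c+c≤q ⟩
    B * q         ≤⟨ suc[q]*q*q≤2*prefixSum q ⟩
    2 * G         ∎)
    where
    identity : ∀ b c → 2 * (b * c) ≡ b * (c + c)
    identity = solve-∀
  2B^B≤N^B : 2 * B ^ B ≤ N ^ B
  2B^B≤N^B = *-cancelʳ-≤ _ _ B (≤-trans (≤-reflexive (identity (B ^ B) B)) (bernoulli B B))
    where
    identity : ∀ x b → 2 * x * b ≡ x * (b + b)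
    identity = solve-∀
  2^c*B^Bc≤N^Bc : 2 ^ c * B ^ (B * c) ≤ N ^ (B * c)
  2^c*B^Bc≤N^Bc = begin
    2 ^ c * B ^ (B * c)     ≡⟨ cong (2 ^ c *_) (^-*-assoc B B c) ⟨
    2 ^ c * (B ^ B) ^ c     ≡⟨ ^-distribʳ-* 2 (B ^ B) c ⟨
    (2 * B ^ B) ^ c         ≤⟨ ^-monoˡ-≤ c 2B^B≤N^B ⟩
    (N ^ B) ^ c             ≡⟨ ^-*-assoc N B c ⟩
    N ^ (B * c)             ∎

greedyTerminates-at-2+q : ∀ d → GreedyTerminatesBy (8 + d) (10 + d)
greedyTerminates-at-2+q 0 = <ᵇ⇒< _ _ tt
greedyTerminates-at-2+q 1 = <ᵇ⇒< _ _ tt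
greedyTerminates-at-2+q 2 = <ᵇ⇒< _ _ tt
greedyTerminates-at-2+q 3 = <ᵇ⇒< _ _ tt
greedyTerminates-at-2+q 4 = <ᵇ⇒< _ _ tt
greedyTerminates-at-2+q 5 = <ᵇ⇒< _ _ tt
greedyTerminates-at-2+q 6 = <ᵇ⇒< _ _ tt
greedyTerminates-at-2+q 7 = <ᵇ⇒< _ _ tt
greedyTerminates-at-2+q 8 = <ᵇ⇒< _ _ tt
greedyTerminates-at-2+q 9 = <ᵇ⇒< _ _ tt
greedyTerminates-at-2+q d@(suc (suc (suc (suc (suc (suc (suc (suc (suc (suc e)))))))))) =
  greedyTerminates-large (8 + d) (m≤m+n 18 e)

-- For q ≤ 7, k is where the greedy bound first drops below 1, and R = q (q + 1) as for larger q.
greedy-size : ∀ q → ∃[ k ] (GreedyTerminatesBy q k × BoundHolds k (suc q))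
greedy-size 0 = 1  , <ᵇ⇒< _ _ tt , inj₁ (s≤s z≤n)
greedy-size 1 = 3  , <ᵇ⇒< _ _ tt , inj₂ (compound⇒ExpLe 2  1  (2 ^ 8) (≤ᵇ⇒≤ _ _ tt))
greedy-size 2 = 5  , <ᵇ⇒< _ _ tt , inj₂ (compound⇒ExpLe 6  9  (3 ^ 12) (≤ᵇ⇒≤ _ _ tt))
greedy-size 3 = 6  , <ᵇ⇒< _ _ tt , inj₂ (compound⇒ExpLe 12 16 (4 ^ 16) (≤ᵇ⇒≤ _ _ tt))
greedy-size 4 = 7  , <ᵇ⇒< _ _ tt , inj₂ (compound⇒ExpLe 20 25 (5 ^ 20) (≤ᵇ⇒≤ _ _ tt))
greedy-size 5 = 8  , <ᵇ⇒< _ _ tt , inj₂ (compound⇒ExpLe 30 36 (6 ^ 24) (≤ᵇ⇒≤ _ _ tt))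
greedy-size 6 = 9  , <ᵇ⇒< _ _ tt , inj₂ (compound⇒ExpLe 42 49 (7 ^ 28) (≤ᵇ⇒≤ _ _ tt))
greedy-size 7 = 10 , <ᵇ⇒< _ _ tt , inj₂ (compound⇒ExpLe 56 64 (8 ^ 32) (≤ᵇ⇒≤ _ _ tt))
greedy-size q@(suc p@(suc (suc (suc (suc (suc (suc (suc d)))))))) =
  let j , j≤q , not-terminated , terminated =
        transition (λ j → greedyTerminatesBy? q (suc j)) (¬greedyTerminatesBy-1 p) (suc q)
                   (greedyTerminates-at-2+q d)
  in 2 + j , terminated , BoundHolds-at-transition p j (≤-pred j≤q) not-terminated

theorem1 : ∀ (q : ℕ) (Π : IncidenceStructure) → IsProjectivePlaneOfOrder q Π →
    Σ (Subset (v Π)) λ S → Saturating Π S × BoundHolds ∣ S ∣ (suc q)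
theorem1 q Π isPP =
  let k , terminated , bound = greedy-size q
      S , saturating , ∣S∣≤k = ProjectivePlane.saturating-set isPP terminated
  in S , saturating , BoundHolds-antitone {X = suc q} ∣S∣≤k bound
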